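{- Let $n,k$ be integers with $2\le k\le n-2$, and let $W\subset\mathbb{Z}_n$ be a subset defining a $d$-alternated minor of $C_n^k$ with $|W|=dn_3$. Then: (i) if $\sum_{s=j}^{r}\delta_s\equiv0\pmod k$ for some indices $j\le r<j+d$ (subscripts of $\delta$ read modulo $dn_3$), then $r=j+d-2$ and $\delta_{r+1}=1$; (ii) if $\delta_s\equiv1\pmod k$ for some $s\in\mathbb{Z}_d$, then $\delta_{s+td}=1$ for all $t\in\mathbb{Z}_{n_3}$.
   Context: $\mathbb{Z}_n=\{0,\dots,n-1\}$ with arithmetic modulo $n$. $C_n^k$ is the $n\times n$ $0,1$ matrix with rows and columns indexed by $\mathbb{Z}_n$ whose $i$-th row is the incidence vector of $\{i,\dots,i+k-1\}\subset\mathbb{Z}_n$. For $N\subset\mathbb{Z}_n$, let $R(N)$ be the set of rows $j$ such that row $j$ of the column-submatrix of $C_n^k$ on columns $\mathbb{Z}_n\setminus N$ entrywise dominates some other row of that submatrix; the minor $C_n^k/N$ is the submatrix with rows $\mathbb{Z}_n\setminus R(N)$ and columns $\mathbb{Z}_n\setminus N$; a circulant minor is one isomorphic (up to row/column permutations) to some $C_{n'}^{k'}$. Let $G(C_n^k)$ be the digraph on $\mathbb{Z}_n$ with arcs $(i,i+k)$ (length $k$) and $(i,i+k+1)$ (length $k+1$). It is known that $C_n^k/N\approx C_{n'}^{k'}$ iff $N$ is the disjoint union of sets $N^0,\dots,N^{d-1}$, each the vertex set of a simple directed cycle of $G(C_n^k)$, all with the same number $n_2$ of arcs of length $k$ and $n_3$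 of arcs of length $k+1$, where $n_1n=kn_2+(k+1)n_3$ with $n_1\ge1$, and $n'=n-d(n_2+n_3)$, $k'=k-dn_1$ (the parameters of the minor). With $W^j=\{i\in N^j:i-(k+1)\in N^j\}$ and $W=\bigcup_jW^j$, the set $W$ determines $N$ and the minor; $W$ is said to define the minor. The minor is relevant if $n'\not\equiv0\pmod{k'}$ and $\lceil n'/k'\rceil>\lceil n/k\rceil$. For $W\subset\mathbb{Z}_n$ with $|W|=m$ write $W=\{i_s:s\in\mathbb{Z}_m\}$ with $0\le i_0<\dots<i_{m-1}\le n-1$, and $\delta_s=i_{s+1}-i_s$ for $s\in\mathbb{Z}_m$ (subscripts modulo $m$, so $\delta_{m-1}=i_0+n-i_{m-1}$). A subset $W=\{i_s:s\in\mathbb{Z}_{dn_3}\}$ defining a relevant minor of $C_n^k$ with parameters $d\ge2$, $n_1=1$, $n_2$, $n_3$ defines a $d$-alternated minor if, for every $j\in\mathbb{Z}_d$, $W^j=\{i_{j+td}:t\in\mathbb{Z}_{n_3}\}$. -}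

module Defs where

open import Data.Nat using (ℕ; zero; suc; _+_; _*_; _∸_; _≤_; _<_; NonZero; _<ᵇ_)
open import Data.Nat.DivMod using (_/_; _%_)
open import Data.Bool using (Bool; if_then_else_; not)
open import Data.List using (upTo; map)
open import Data.Nat.ListAction using (sum)
open import Data.Fin using (Fin; toℕ)
open import Data.Product using (Σ; ∃; _×_; _,_)
open import Relation.Binary.PropositionalEquality using (_≡_; _≢_)
open import Relation.Nullary using (¬_)
open import Function.Bundles using (_⇔_)

-- Elements of ℤ_n are represented by natural numbers < n; arithmetic is taken mod n.

ceilDiv : (a b : ℕ) → .{{NonZero b}} → ℕ
ceilDiv a b = (a + b ∸ 1) / b

-- A simple directed cycle of G(C_n^k), given by its vertex sequence
-- vert 0, vert 1, …, vert (len-1) (extended periodically), where the arc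
-- from vert l to vert (l+1) has length k+1 if long l = true and length k otherwise.
record SimpleCycle (n k : ℕ) .{{_ : NonZero n}} : Set where
  field
    len      : ℕ
    vert     : ℕ → ℕ
    long     : ℕ → Bool
    len≥1    : 1 ≤ len
    vert<n   : ∀ l → vert l < n
    periodic : ∀ l → vert (l + len) ≡ vert l
    arc      : ∀ l → vert (suc l) ≡ (vert l + k + (if long l then 1 else 0)) % n
    simple   : ∀ l l' → l < l' → l' < len → vert l ≢ vert l'

module _ {n k : ℕ} .{{_ : NonZero n}} (c : SimpleCycle n k) where
  open SimpleCycle c

  nLong : ℕ
  nLong = sum (map (λ l → if long l then 1 else 0) (upTo len))

  nShort : ℕ
  nShort = sum (map (λ l → if long l then 0 else 1) (upTo len))

  InN : ℕ → Set
  InN x = ∃ λ l → l < len × vert l ≡ x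

  InW : ℕ → Set
  InW x = InN x × InN ((x + n ∸ suc k) % n)

Enumerates : (n m : ℕ) → (ℕ → ℕ) → Set
Enumerates n m i = (∀ s → s < m → i s < n) × (∀ s → suc s < m → i s < i (suc s))

-- δ_s = i_{s+1} - i_s, with δ_{m-1} = i_0 + n - i_{m-1}, subscripts read modulo m.
delta : (n m : ℕ) → (ℕ → ℕ) → ℕ → ℕ
delta n zero i s = 0
delta n (suc m') i s = raw (s % suc m')
  where
  raw : ℕ → ℕ
  raw t = if suc t <ᵇ suc m' then i (suc t) ∸ i t else i 0 + n ∸ i t

sumDelta : (n m : ℕ) → (ℕ → ℕ) → (j r : ℕ) → ℕ
sumDelta n m i j r = sum (map (λ u → delta n m i (j + u)) (upTo (suc r ∸ j)))

-- The minor with parameters d, n₁, n₂, n₃ (n' = n - d(n₂+n₃), k' = k - d n₁) is relevant: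
-- n' ≢ 0 (mod k') and ⌈n'/k'⌉ > ⌈n/k⌉  (k' ≥ 1 as C_{n'}^{k'} is a circulant).
Relevant : (n k : ℕ) .{{_ : NonZero k}} → (d n₁ n₂ n₃ : ℕ) → Set
Relevant n k d n₁ n₂ n₃ =
  Σ (NonZero (k ∸ d * n₁)) λ nz →
    (_%_ (n ∸ d * (n₂ + n₃)) (k ∸ d * n₁) {{nz}} ≢ 0)
    × (ceilDiv n k < ceilDiv (n ∸ d * (n₂ + n₃)) (k ∸ d * n₁) {{nz}})

DefinesMinorVia : (n k : ℕ) .{{_ : NonZero n}} → (m : ℕ) → (ℕ → ℕ) →
                  (d n₁ n₂ n₃ : ℕ) → (Fin d → SimpleCycle n k) → Set
DefinesMinorVia n k m i d n₁ n₂ n₃ c =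
    (∀ j → nShort (c j) ≡ n₂ × nLong (c j) ≡ n₃)
  × (∀ j j' → j ≢ j' → ∀ x → InN (c j) x → InN (c j') x → Data.Empty.⊥)
  × (1 ≤ n₁) × (n₁ * n ≡ k * n₂ + (k + 1) * n₃)
  × (∀ x → (∃ λ s → s < m × i s ≡ x) ⇔ (∃ λ j → InW (c j) x))
  where import Data.Empty

DAlternated : (n k : ℕ) .{{_ : NonZero n}} .{{_ : NonZero k}} → (ℕ → ℕ) → (d n₂ n₃ : ℕ) → Set
DAlternated n k i d n₂ n₃ =
  2 ≤ d × Relevant n k d 1 n₂ n₃ ×
  Σ (Fin d → SimpleCycle n k) λ c →
      DefinesMinorVia n k (d * n₃) i d 1 n₂ n₃ c
    × (∀ (j : Fin d) x → InW (c j) x ⇔ (∃ λ t → t < n₃ × i (toℕ j + t * d) ≡ x))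

module Submission where

open import Defs
open import Data.Nat using (ℕ; suc; _+_; _*_; _∸_; _≤_; _<_; NonZero)
open import Data.Nat.DivMod using (_%_)
open import Data.Nat.Divisibility using (_∣_)
open import Data.Product using (_×_)
open import Relation.Binary.PropositionalEquality using (_≡_)

open import Data.Nat
open import Data.Nat.Properties
open import Data.Nat.DivMod
open import Data.Nat.Divisibility using (divides; ∣⇒≤; ∣m+n∣m⇒∣n; n∣m*n; ∣1⇒≡1)
open import Data.Nat.ListAction using (sum)
open import Data.Nat.ListAction.Properties using (sum-++)
open import Data.Nat.Tactic.RingSolver using (solve-∀)
open import Algebra.Properties.CommutativeSemigroup +-commutativeSemigroup using (xy∙z≈xz∙y; xy∙z≈x∙zy; x∙yz≈xz∙y)
open import Data.List using (upTo; map; [_]; _++_)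
open import Data.List.Properties using (upTo-∷ʳ; map-++)
open import Data.Bool using (Bool; true; false; if_then_else_)
open import Data.Bool.Properties using (¬-not)
open import Data.Unit using (tt)
open import Data.Fin using (Fin; toℕ; fromℕ<)
open import Data.Fin.Properties using (toℕ-fromℕ<; toℕ-injective; toℕ<n)
open import Data.Product using (∃; _,_; proj₁; proj₂)
open import Data.Sum using (_⊎_; inj₁; inj₂)
open import Data.Empty using (⊥; ⊥-elim)
open import Function.Bundles using (Equivalence; _⇔_)
open import Relation.Nullary using (yes; no)
open import Relation.Binary.Definitions using (tri<; tri≈; tri>)
open import Relation.Binary.PropositionalEquality
  using (_≢_; refl; sym; trans; cong; cong₂; subst; subst₂; module ≡-Reasoning)


-- Lift W = {i_0 < ⋯ < i_{m-1}} ⊂ ℤ_n to the increasing sequence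
-- I s = i_0 + δ_0 + ⋯ + δ_{s-1}, so that I (s + m) = I s + n, and lift each cycle
-- N^a of G(C_n^k) to the walk U along its arcs of lengths k and k + 1.  Both are
-- prefix sums of a periodic positive sequence (module PrefixSum); in particular a
-- window (F j, F j + n] meets every residue class of F-values exactly once.  On a
-- cycle any two vertices are at least k ≥ 2 apart, hence a vertex lies in W exactly
-- when the arc entering it is long (module Cycle).  For a d-alternated W, the points
-- of W^a are the I s with s ≡ a (mod d), so walking from I j along N^{j mod d} one
-- meets only short arcs before the long arc entering I (j + d):
-- I (j + d) = I j + p k + (k + 1), and all I j + r k (r ≤ p) lie on N^{j mod d}
-- (FromIndex.arrival).  As the cycles are disjoint, a block of e ≤ d gaps starting
-- at j whose sum is divisible by k ends exactly one before I (j + d)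
-- (divisible-block).  This is part (i); applied to the d - 1 gaps following a gap
-- δ_s ≡ 1 (mod k) it yields δ_{s+d} = 1, which iterates to part (ii).

Σ< : ℕ → (ℕ → ℕ) → ℕ
Σ< zero    f = 0
Σ< (suc L) f = Σ< L f + f L

sum-upTo : ∀ (f : ℕ → ℕ) L → sum (map f (upTo L)) ≡ Σ< L f
sum-upTo f zero    = refl
sum-upTo f (suc L) = begin
  sum (map f (upTo (suc L)))            ≡⟨ cong (λ xs → sum (map f xs)) (sym (upTo-∷ʳ L)) ⟩
  sum (map f (upTo L ++ [ L ]))         ≡⟨ cong sum (map-++ f (upTo L) [ L ]) ⟩
  sum (map f (upTo L) ++ [ f L ])       ≡⟨ sum-++ (map f (upTo L)) [ f L ] ⟩
  sum (map f (upTo L)) + (f L + 0)      ≡⟨ cong₂ _+_ (sum-upTo f L) (+-identityʳ (f L)) ⟩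
  Σ< L f + f L                          ∎
  where open ≡-Reasoning

%-absorbˡ : ∀ n .{{_ : NonZero n}} a b → (a % n + b) % n ≡ (a + b) % n
%-absorbˡ n a b = begin
  (a % n + b) % n          ≡⟨ %-distribˡ-+ (a % n) b n ⟩
  (a % n % n + b % n) % n  ≡⟨ cong (λ z → (z + b % n) % n) (m%n%n≡m%n a n) ⟩
  (a % n + b % n) % n      ≡⟨ %-distribˡ-+ a b n ⟨
  (a + b) % n              ∎
  where open ≡-Reasoning

congruent⇒∣∸ : ∀ k .{{_ : NonZero k}} a b → a % k ≡ b % k → b ≤ a → k ∣ a ∸ b
congruent⇒∣∸ k a b a≡b b≤a = divides (a / k ∸ b / k) (begin
  a ∸ b                                    ≡⟨ cong₂ _∸_ a-split (m≡m%n+[m/n]*n b k) ⟩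
  (b % k + a / k * k) ∸ (b % k + b / k * k) ≡⟨ [m+n]∸[m+o]≡n∸o (b % k) (a / k * k) (b / k * k) ⟩
  a / k * k ∸ b / k * k                    ≡⟨ *-distribʳ-∸ k (a / k) (b / k) ⟨
  (a / k ∸ b / k) * k                      ∎)
  where
  open ≡-Reasoning
  a-split : a ≡ b % k + a / k * k
  a-split = trans (m≡m%n+[m/n]*n a k) (cong (_+ a / k * k) a≡b)

congruent-gap : ∀ d .{{_ : NonZero d}} {u v} → u % d ≡ v % d → u < v → u + d ≤ v
congruent-gap d {u} {v} u≡v u<v = begin
  u + d            ≤⟨ +-monoʳ-≤ u (∣⇒≤ {{>-nonZero (m<n⇒0<n∸m u<v)}} d∣v∸u) ⟩
  u + (v ∸ u)      ≡⟨ m+[n∸m]≡n (<⇒≤ u<v) ⟩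
  v                ∎
  where
  open ≤-Reasoning
  d∣v∸u : d ∣ v ∸ u
  d∣v∸u = congruent⇒∣∸ d v u (sym u≡v) (<⇒≤ u<v)

congruent-window : ∀ n .{{_ : NonZero n}} {A a b} → A < a → a ≤ A + n → A < b → b ≤ A + n →
                   a % n ≡ b % n → a ≡ b
congruent-window n {A} {a} {b} A<a a≤ A<b b≤ a≡b with <-cmp a b
... | tri≈ _ eq _ = eq
... | tri< a<b _ _ = ⊥-elim (<⇒≱ (+-monoˡ-< n A<a) (≤-trans (congruent-gap n a≡b a<b) b≤))
... | tri> _ _ b<a = ⊥-elim (<⇒≱ (+-monoˡ-< n A<b) (≤-trans (congruent-gap n (sym a≡b) b<a) a≤))

suc-incongruent : ∀ n .{{_ : NonZero n}} → 2 ≤ n → ∀ x → (x + 1) % n ≢ x % n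
suc-incongruent n 2≤n x eq =
  <⇒≱ 2≤n (+-cancelˡ-≤ x n 1 (congruent-gap n (sym eq) (m<m+n x z<s)))

-- Both the
-- positions of W lifted from ℤ_n to ℕ and the walk along a cycle of G(C_n^k) are
-- of this form; all order and window arguments are made once, here.
module PrefixSum (g : ℕ → ℕ) (g-pos : ∀ s → 1 ≤ g s) (F₀ : ℕ) where

  F : ℕ → ℕ
  F zero    = F₀
  F (suc s) = F s + g s

  F-Σ : ∀ j l → F (j + l) ≡ F j + Σ< l (λ u → g (j + u))
  F-Σ j zero    = trans (cong F (+-identityʳ j)) (sym (+-identityʳ (F j)))
  F-Σ j (suc l) = begin
    F (j + suc l)                            ≡⟨ cong F (+-suc j l) ⟩
    F (j + l) + g (j + l)                    ≡⟨ cong (_+ g (j + l)) (F-Σ j l) ⟩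
    F j + Σ< l (λ u → g (j + u)) + g (j + l) ≡⟨ +-assoc (F j) _ _ ⟩
    F j + Σ< (suc l) (λ u → g (j + u))       ∎
    where open ≡-Reasoning

  F-mono : ∀ {s s'} → s ≤ s' → F s ≤ F s'
  F-mono {s} {s'} s≤s' =
    subst (F s ≤_) (trans (sym (F-Σ s (s' ∸ s))) (cong F (m+[n∸m]≡n s≤s'))) (m≤m+n (F s) _)

  F-gap : ∀ {c} → (∀ s → c ≤ g s) → ∀ {s s'} → s < s' → F s + c ≤ F s'
  F-gap g≥c {s} s<s' = ≤-trans (+-monoʳ-≤ (F s) (g≥c s)) (F-mono s<s')

  F-smono : ∀ {s s'} → s < s' → F s < F s'
  F-smono {s} {s'} s<s' = subst (_≤ F s') (+-comm (F s) 1) (F-gap g-pos s<s')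

  F-just-before : ∀ {j e d} → e < d → F (j + e) + 1 ≡ F (j + d) → suc e ≡ d × g (j + e) ≡ 1
  F-just-before {j} {e} {d} e<d F+1≡F with m≤n⇒m<n∨m≡n e<d
  ... | inj₁ 1+e<d = ⊥-elim (<-irrefl (trans (+-comm 1 (F (j + e))) F+1≡F) two-steps)
    where
    two-steps : suc (F (j + e)) < F (j + d)
    two-steps = ≤-<-trans (F-smono (+-monoʳ-< j (n<1+n e))) (F-smono (+-monoʳ-< j 1+e<d))
  ... | inj₂ 1+e≡d = 1+e≡d , +-cancelˡ-≡ (F (j + e)) _ _ (begin
    F (j + e) + g (j + e)  ≡⟨ cong F (+-suc j e) ⟨
    F (j + suc e)          ≡⟨ cong (λ t → F (j + t)) 1+e≡d ⟩
    F (j + d)              ≡⟨ F+1≡F ⟨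
    F (j + e) + 1          ∎)
    where open ≡-Reasoning

  module Periodic (L n : ℕ) .{{_ : NonZero L}} .{{_ : NonZero n}}
                  (g-per : ∀ s → g (s + L) ≡ g s) (total : Σ< L g ≡ n) where

    F-period : ∀ s → F (s + L) ≡ F s + n
    F-period zero    = trans (F-Σ 0 L) (cong (F₀ +_) total)
    F-period (suc s) = begin
      F (s + L) + g (s + L)  ≡⟨ cong₂ _+_ (F-period s) (g-per s) ⟩
      F s + n + g s          ≡⟨ xy∙z≈xz∙y (F s) n (g s) ⟩
      F s + g s + n          ∎
      where open ≡-Reasoning

    F-periods : ∀ r q → F (r + q * L) ≡ F r + q * n
    F-periods r zero    = trans (cong F (+-identityʳ r)) (sym (+-identityʳ (F r)))
    F-periods r (suc q) = begin
      F (r + (L + q * L))  ≡⟨ cong F (x∙yz≈xz∙y r L (q * L)) ⟩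
      F (r + q * L + L)    ≡⟨ F-period (r + q * L) ⟩
      F (r + q * L) + n    ≡⟨ cong (_+ n) (F-periods r q) ⟩
      F r + q * n + n      ≡⟨ xy∙z≈x∙zy (F r) (q * n) n ⟩
      F r + (n + q * n)    ∎
      where open ≡-Reasoning

    Σ-period : ∀ a → Σ< L (λ u → g (a + u)) ≡ n
    Σ-period a = +-cancelˡ-≡ (F a) _ _ (trans (sym (F-Σ a L)) (F-period a))

    F-mod : ∀ s → F s % n ≡ F (s % L) % n
    F-mod s = begin
      F s % n                           ≡⟨ cong (λ t → F t % n) (m≡m%n+[m/n]*n s L) ⟩
      F (s % L + s / L * L) % n         ≡⟨ cong (_% n) (F-periods (s % L) (s / L)) ⟩
      (F (s % L) + s / L * n) % n       ≡⟨ [m+kn]%n≡m%n (F (s % L)) (s / L) n ⟩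
      F (s % L) % n                     ∎
      where open ≡-Reasoning

    -- A window (F j, F j + n] meets each residue class of F-values mod n at an index
    -- t ∈ (j, j + L] of the corresponding class mod L; first for j < L, ...
    window₀ : ∀ {j s z} → j < L → F j < z → z ≤ F j + n → z % n ≡ F s % n →
              ∃ λ t → j < t × t ≤ j + L × t % L ≡ s % L × F t ≡ z
    window₀ {j} {s} {z} j<L Fj<z z≤ z≡Fs = conclude candidate
      where
      r = s % L
      -- t = r if j < r, and t = r + L otherwise
      candidate : ∃ λ t → j < t × t ≤ j + L × t % L ≡ r × F t % n ≡ F r % n
      candidate with j <? r
      ... | yes j<r = r , j<r , ≤-trans (<⇒≤ (m%n<n s L)) (m≤n+m L j) , m%n%n≡m%n s L , refl
      ... | no  j≮r = r + L , <-≤-trans j<L (m≤n+m L r) , +-monoˡ-≤ L (≮⇒≥ j≮r)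
                    , trans ([m+n]%n≡m%n r L) (m%n%n≡m%n s L)
                    , trans (cong (_% n) (F-period r)) ([m+n]%n≡m%n (F r) n)
      conclude : (∃ λ t → j < t × t ≤ j + L × t % L ≡ r × F t % n ≡ F r % n) →
                 ∃ λ t → j < t × t ≤ j + L × t % L ≡ s % L × F t ≡ z
      conclude (t , j<t , t≤ , t≡r , Ft≡Fr) =
        t , j<t , t≤ , t≡r ,
        congruent-window n (F-smono j<t) (subst (F t ≤_) (F-period j) (F-mono t≤)) Fj<z z≤
          (trans Ft≡Fr (trans (sym (F-mod s)) (sym z≡Fs)))

    -- ... and then for arbitrary j, by shifting j, t and z by q = j / L whole periods.
    window : ∀ {j s z} → F j < z → z ≤ F j + n → z % n ≡ F s % n →
             ∃ λ t → j < t × t ≤ j + L × t % L ≡ s % L × F t ≡ z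
    window {j} {s} {z} Fj<z z≤ z≡Fs = shift (window₀ (m%n<n j L) lower upper residue)
      where
      q = j / L
      j≡ : j % L + q * L ≡ j
      j≡ = sym (m≡m%n+[m/n]*n j L)
      Fj≡ : F j ≡ F (j % L) + q * n
      Fj≡ = trans (cong F (sym j≡)) (F-periods (j % L) q)
      z≡ : z ∸ q * n + q * n ≡ z
      z≡ = m∸n+n≡m (≤-trans (m≤n+m (q * n) (F (j % L))) (<⇒≤ (subst (_< z) Fj≡ Fj<z)))
      lower : F (j % L) < z ∸ q * n
      lower = +-cancelʳ-< (q * n) _ _ (subst₂ _<_ Fj≡ (sym z≡) Fj<z)
      upper : z ∸ q * n ≤ F (j % L) + n
      upper = +-cancelʳ-≤ (q * n) _ _
                (subst₂ _≤_ (sym z≡) (trans (cong (_+ n) Fj≡) (xy∙z≈xz∙y _ (q * n) n)) z≤)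
      residue : (z ∸ q * n) % n ≡ F s % n
      residue = trans (sym ([m+kn]%n≡m%n (z ∸ q * n) q n)) (trans (cong (_% n) z≡) z≡Fs)
      shift : (∃ λ t → j % L < t × t ≤ j % L + L × t % L ≡ s % L × F t ≡ z ∸ q * n) →
              ∃ λ t → j < t × t ≤ j + L × t % L ≡ s % L × F t ≡ z
      shift (t , j%L<t , t≤ , t≡s , Ft≡) =
          t + q * L
        , subst (_< t + q * L) j≡ (+-monoˡ-< (q * L) j%L<t)
        , subst (t + q * L ≤_) (trans (xy∙z≈xz∙y (j % L) L (q * L)) (cong (_+ L) j≡))
            (+-monoˡ-≤ (q * L) t≤)
        , trans ([m+kn]%n≡m%n t q L) t≡s
        , trans (F-periods t q) (trans (cong (_+ q * n) Ft≡) z≡)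

bit : Bool → ℕ
bit b = if b then 1 else 0

bit-injective-mod : ∀ n .{{_ : NonZero n}} → 2 ≤ n →
                    ∀ x b b' → (x + bit b) % n ≡ (x + bit b') % n → b ≡ b'
bit-injective-mod n 2≤n x true  true  _  = refl
bit-injective-mod n 2≤n x false false _  = refl
bit-injective-mod n 2≤n x true  false eq =
  ⊥-elim (suc-incongruent n 2≤n x (trans eq (cong (_% n) (+-identityʳ x))))
bit-injective-mod n 2≤n x false true  eq =
  ⊥-elim (suc-incongruent n 2≤n x (sym (trans (cong (_% n) (sym (+-identityʳ x))) eq)))

arc-count-step : ∀ k A S T (b : Bool) → A ≡ k * S + (k + 1) * T →
                 A + (k + bit b) ≡ k * (S + (if b then 0 else 1)) + (k + 1) * (T + bit b)
arc-count-step k A S T true  refl = long-step k S T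
  where
  long-step : ∀ k S T → k * S + (k + 1) * T + (k + 1) ≡ k * (S + 0) + (k + 1) * (T + 1)
  long-step = solve-∀
arc-count-step k A S T false refl = short-step k S T
  where
  short-step : ∀ k S T → k * S + (k + 1) * T + (k + 0) ≡ k * (S + 1) + (k + 1) * (T + 0)
  short-step = solve-∀

module Cycle (n k : ℕ) .{{_ : NonZero n}} (k≥2 : 2 ≤ k) (k+2≤n : k + 2 ≤ n)
             (c : SimpleCycle n k) (n₂ n₃ : ℕ)
             (#short : nShort c ≡ n₂) (#long : nLong c ≡ n₃)
             (balance : 1 * n ≡ k * n₂ + (k + 1) * n₃) where

  open SimpleCycle c

  instance
    len-nonZero : NonZero len
    len-nonZero = >-nonZero len≥1

  2≤n : 2 ≤ n
  2≤n = ≤-trans (m≤n+m 2 k) k+2≤n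

  1+k≤n : suc k ≤ n
  1+k≤n = ≤-trans (n≤1+n (suc k)) (subst (_≤ n) (+-comm k 2) k+2≤n)

  -- the complement n - (k+1): subtracting k+1 in ℤ_n means adding e
  e : ℕ
  e = n ∸ suc k

  minus-arc : ∀ x → x + n ∸ suc k ≡ x + e
  minus-arc x = +-∸-assoc x 1+k≤n

  k+1+e≡n : ∀ x → x + k + 1 + e ≡ x + n
  k+1+e≡n x = trans (rearrange x k e) (cong (x +_) (m+[n∸m]≡n 1+k≤n))
    where
    rearrange : ∀ x k e → x + k + 1 + e ≡ x + (suc k + e)
    rearrange = solve-∀

  w : ℕ → ℕ
  w l = k + bit (long l)

  w≥k : ∀ l → k ≤ w l
  w≥k l = m≤m+n k (bit (long l))

  w-pos : ∀ l → 1 ≤ w l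
  w-pos l = ≤-trans (≤-trans (s≤s z≤n) k≥2) (w≥k l)

  vert-periods : ∀ r q → vert (r + q * len) ≡ vert r
  vert-periods r zero    = cong vert (+-identityʳ r)
  vert-periods r (suc q) = begin
    vert (r + (len + q * len))  ≡⟨ cong vert (x∙yz≈xz∙y r len (q * len)) ⟩
    vert (r + q * len + len)    ≡⟨ periodic (r + q * len) ⟩
    vert (r + q * len)          ≡⟨ vert-periods r q ⟩
    vert r                      ∎
    where open ≡-Reasoning

  InN-vert : ∀ l → InN c (vert l)
  InN-vert l = l % len , m%n<n l len
             , trans (sym (vert-periods (l % len) (l / len))) (cong vert (sym (m≡m%n+[m/n]*n l len)))

  -- The arc types repeat with the period of the cycle, since the vertices do.
  long-per : ∀ l → long (l + len) ≡ long l
  long-per l = bit-injective-mod n 2≤n (vert l + k) (long (l + len)) (long l) (begin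
    (vert l + k + bit (long (l + len))) % n
      ≡⟨ cong (λ v → (v + k + bit (long (l + len))) % n) (sym (periodic l)) ⟩
    (vert (l + len) + k + bit (long (l + len))) % n  ≡⟨ arc (l + len) ⟨
    vert (suc l + len)                               ≡⟨ periodic (suc l) ⟩
    vert (suc l)                                     ≡⟨ arc l ⟩
    (vert l + k + bit (long l)) % n                  ∎)
    where open ≡-Reasoning

  Σ-arcs : ∀ L → Σ< L w ≡ k * Σ< L (λ l → if long l then 0 else 1) + (k + 1) * Σ< L (λ l → bit (long l))
  Σ-arcs zero    = sym (cong₂ _+_ (*-zeroʳ k) (*-zeroʳ (k + 1)))
  Σ-arcs (suc L) = arc-count-step k _ _ _ (long L) (Σ-arcs L)

  Σ-w : Σ< len w ≡ n
  Σ-w = begin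
    Σ< len w
      ≡⟨ Σ-arcs len ⟩
    k * Σ< len (λ l → if long l then 0 else 1) + (k + 1) * Σ< len (λ l → bit (long l))
      ≡⟨ cong₂ (λ a b → k * a + (k + 1) * b)
               (trans (sym (sum-upTo _ len)) #short) (trans (sym (sum-upTo _ len)) #long) ⟩
    k * n₂ + (k + 1) * n₃  ≡⟨ sym balance ⟩
    1 * n                  ≡⟨ *-identityˡ n ⟩
    n                      ∎
    where open ≡-Reasoning

  w-per : ∀ l → w (l + len) ≡ w l
  w-per l = cong (λ b → k + bit b) (long-per l)

  Σ-w-from : ∀ l₀ → Σ< len (λ q → w (l₀ + q)) ≡ n
  Σ-w-from = PrefixSum.Periodic.Σ-period w w-pos 0 len n w-per Σ-w

  -- The walk along the cycle from vertex l₀, lifted to ℕ from a start x ≡ vert l₀: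
  -- U q is the position reached after q arcs.
  module Walk (l₀ : ℕ) (l₀<len : l₀ < len) (x : ℕ) (x≡ : x % n ≡ vert l₀) where

    walk-per : ∀ q → w (l₀ + (q + len)) ≡ w (l₀ + q)
    walk-per q = trans (cong w (sym (+-assoc l₀ q len))) (w-per (l₀ + q))

    open PrefixSum (λ q → w (l₀ + q)) (λ q → w-pos (l₀ + q)) x public
      renaming (F to U)
    open Periodic len n walk-per (Σ-w-from l₀) public

    U-mod : ∀ q → U q % n ≡ vert (l₀ + q)
    U-mod zero    = trans x≡ (cong vert (sym (+-identityʳ l₀)))
    U-mod (suc q) = begin
      (U q + w (l₀ + q)) % n               ≡⟨ %-absorbˡ n (U q) (w (l₀ + q)) ⟨
      (U q % n + w (l₀ + q)) % n           ≡⟨ cong (λ v → (v + w (l₀ + q)) % n) (U-mod q) ⟩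
      (vert (l₀ + q) + w (l₀ + q)) % n     ≡⟨ cong (_% n) (+-assoc (vert (l₀ + q)) k _) ⟨
      (vert (l₀ + q) + k + bit (long (l₀ + q))) % n ≡⟨ arc (l₀ + q) ⟨
      vert (suc (l₀ + q))                  ≡⟨ cong vert (+-suc l₀ q) ⟨
      vert (l₀ + suc q)                    ∎
      where open ≡-Reasoning

    reach : ∀ {y} → InN c y → ∃ λ s → U s % n ≡ y
    reach {y} (l , l<len , vl≡y) = l + len ∸ l₀ , (begin
      U (l + len ∸ l₀) % n       ≡⟨ U-mod (l + len ∸ l₀) ⟩
      vert (l₀ + (l + len ∸ l₀)) ≡⟨ cong vert (m+[n∸m]≡n (≤-trans (<⇒≤ l₀<len) (m≤n+m len l))) ⟩
      vert (l + len)             ≡⟨ periodic l ⟩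
      vert l                     ≡⟨ vl≡y ⟩
      y                          ∎)
      where open ≡-Reasoning

    walk-window : ∀ {z} → InN c (z % n) → x < z → z ≤ x + n →
                  ∃ λ q → 0 < q × q ≤ len × U q ≡ z
    walk-window z∈N x<z z≤ =
      let q , 0<q , q≤len , _ , Uq≡z = window {0} {proj₁ (reach z∈N)} x<z z≤ (sym (proj₂ (reach z∈N)))
      in  q , 0<q , q≤len , Uq≡z

    walk-linear : ∀ p → (∀ r → r < p → long (l₀ + r) ≡ false) → U p ≡ x + p * k
    walk-linear zero    _     = sym (+-identityʳ x)
    walk-linear (suc p) short = begin
      U p + (k + bit (long (l₀ + p)))  ≡⟨ cong₂ (λ u b → u + (k + bit b)) (walk-linear p short<p) (short p ≤-refl) ⟩
      x + p * k + (k + 0)              ≡⟨ linear-step x p k ⟩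
      x + suc p * k                    ∎
      where
      open ≡-Reasoning
      short<p : ∀ r → r < p → long (l₀ + r) ≡ false
      short<p r r<p = short r (m<n⇒m<1+n r<p)
      linear-step : ∀ x p k → x + p * k + (k + 0) ≡ x + (1 + p) * k
      linear-step = solve-∀

  -- Two vertices of the cycle are never adjacent in ℤ_n: all arcs have length ≥ k ≥ 2.
  no-adjacent : ∀ u → InN c (u % n) → InN c ((u + 1) % n) → ⊥
  no-adjacent u (l , l<len , vl≡u) u+1∈N =
    let q , 0<q , _ , Uq≡u+1 = walk-window u+1∈N (m<m+n u z<s) (+-monoʳ-≤ u (≤-trans (s≤s z≤n) 2≤n))
    in  <⇒≱ k≥2 (+-cancelˡ-≤ u k 1 (subst (u + k ≤_) Uq≡u+1 (F-gap (λ q → w≥k (l + q)) 0<q)))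
    where open Walk l l<len u (sym vl≡u)

  arc-typed : ∀ l {b} → long l ≡ b → vert (suc l) ≡ (vert l + k + bit b) % n
  arc-typed l refl = arc l

  full-turn : ∀ l → (vert l + k + 1 + e) % n ≡ vert l
  full-turn l = begin
    (vert l + k + 1 + e) % n  ≡⟨ cong (_% n) (k+1+e≡n (vert l)) ⟩
    (vert l + n) % n          ≡⟨ [m+n]%n≡m%n (vert l) n ⟩
    vert l % n                ≡⟨ m<n⇒m%n≡m (vert<n l) ⟩
    vert l                    ∎
    where open ≡-Reasoning

  long⇒InW : ∀ l → long l ≡ true → InW c (vert (suc l))
  long⇒InW l is-long = InN-vert (suc l) , subst (InN c) (sym predecessor) (InN-vert l)
    where
    open ≡-Reasoning
    predecessor : (vert (suc l) + n ∸ suc k) % n ≡ vert l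
    predecessor = begin
      (vert (suc l) + n ∸ suc k) % n  ≡⟨ cong (_% n) (minus-arc (vert (suc l))) ⟩
      (vert (suc l) + e) % n          ≡⟨ cong (λ v → (v + e) % n) (arc-typed l is-long) ⟩
      ((vert l + k + 1) % n + e) % n  ≡⟨ %-absorbˡ n (vert l + k + 1) e ⟩
      (vert l + k + 1 + e) % n        ≡⟨ full-turn l ⟩
      vert l                          ∎

  -- If the arc entering vert (l+1) were short, its (k+1)-predecessor would be
  -- adjacent to vert l.
  InW⇒long : ∀ l → InW c (vert (suc l)) → long l ≡ true
  InW⇒long l (_ , pred∈N) with long l in is-long
  ... | true  = refl
  ... | false = ⊥-elim (no-adjacent (vert (suc l) + e)
                  (subst (λ v → InN c (v % n)) (minus-arc (vert (suc l))) pred∈N)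
                  (subst (InN c) (sym next) (InN-vert l)))
    where
    open ≡-Reasoning
    next : (vert (suc l) + e + 1) % n ≡ vert l
    next = begin
      (vert (suc l) + e + 1) % n            ≡⟨ cong (λ v → (v + e + 1) % n) (arc-typed l is-long) ⟩
      ((vert l + k + 0) % n + e + 1) % n    ≡⟨ cong (_% n) (+-assoc ((vert l + k + 0) % n) e 1) ⟩
      ((vert l + k + 0) % n + (e + 1)) % n  ≡⟨ %-absorbˡ n (vert l + k + 0) (e + 1) ⟩
      (vert l + k + 0 + (e + 1)) % n        ≡⟨ cong (_% n) (short-around (vert l) k e) ⟩
      (vert l + k + 1 + e) % n              ≡⟨ full-turn l ⟩
      vert l                                ∎
      where
      short-around : ∀ x k e → x + k + 0 + (e + 1) ≡ x + k + 1 + e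
      short-around = solve-∀

-- The enumeration i_0 < ⋯ < i_{m-1} of W ⊂ ℤ_n (m = m' + 1) lifted to ℕ:
-- I s = i_0 + δ_0 + ⋯ + δ_{s-1}, so that I s = i_s for s < m and I (s + m) = I s + n.
module LiftW (n : ℕ) .{{_ : NonZero n}} (m' : ℕ) (i : ℕ → ℕ) (en : Enumerates n (suc m') i) where

  m : ℕ
  m = suc m'

  δ : ℕ → ℕ
  δ = delta n m i

  -- δ s unfolds to δ-raw (s % m)
  δ-raw : ℕ → ℕ
  δ-raw t = if suc t <ᵇ suc m' then i (suc t) ∸ i t else i 0 + n ∸ i t

  δ-raw-inner : ∀ t → suc t < m → δ-raw t ≡ i (suc t) ∸ i t
  δ-raw-inner t st<m with suc t <ᵇ suc m' | <⇒<ᵇ st<m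
  ... | true  | _  = refl
  ... | false | ()

  δ-raw-last : δ-raw m' ≡ i 0 + n ∸ i m'
  δ-raw-last with suc m' <ᵇ suc m' | <ᵇ⇒< (suc m') (suc m')
  ... | false | _     = refl
  ... | true  | m<m = ⊥-elim (<-irrefl refl (m<m tt))

  δ-per : ∀ s → δ (s + m) ≡ δ s
  δ-per s = cong δ-raw ([m+n]%n≡m%n s m)

  -- consecutive elements of W are distinct points of ℤ_n
  δ-pos : ∀ s → 1 ≤ δ s
  δ-pos s with m<1+n⇒m<n∨m≡n (m%n<n s m)
  ... | inj₁ s%m<m' = subst (1 ≤_) (sym (δ-raw-inner (s % m) (s≤s s%m<m')))
                        (m<n⇒0<n∸m (proj₂ en (s % m) (s≤s s%m<m')))
  ... | inj₂ s%m≡m' = subst (λ t → 1 ≤ δ-raw t) (sym s%m≡m') (subst (1 ≤_) (sym δ-raw-last)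
                        (m<n⇒0<n∸m (<-≤-trans (proj₁ en m' ≤-refl) (m≤n+m n (i 0)))))

  open PrefixSum δ δ-pos (i 0) public renaming (F to I)

  I-inner : ∀ s → s < m → I s ≡ i s
  I-inner zero    _      = refl
  I-inner (suc s) 1+s<m = begin
    I s + δ-raw (s % m)     ≡⟨ cong₂ (λ a t → a + δ-raw t) (I-inner s (<⇒≤ 1+s<m)) (m<n⇒m%n≡m (<⇒≤ 1+s<m)) ⟩
    i s + δ-raw s           ≡⟨ cong (i s +_) (δ-raw-inner s 1+s<m) ⟩
    i s + (i (suc s) ∸ i s) ≡⟨ m+[n∸m]≡n (<⇒≤ (proj₂ en s 1+s<m)) ⟩
    i (suc s)               ∎
    where open ≡-Reasoning

  I-round : I m ≡ i 0 + n
  I-round = begin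
    I m' + δ-raw (m' % m)     ≡⟨ cong₂ (λ a t → a + δ-raw t) (I-inner m' ≤-refl) (m<n⇒m%n≡m ≤-refl) ⟩
    i m' + δ-raw m'           ≡⟨ cong (i m' +_) δ-raw-last ⟩
    i m' + (i 0 + n ∸ i m')   ≡⟨ m+[n∸m]≡n (<⇒≤ (<-≤-trans (proj₁ en m' ≤-refl) (m≤n+m n (i 0)))) ⟩
    i 0 + n                   ∎
    where open ≡-Reasoning

  Σ-δ : Σ< m δ ≡ n
  Σ-δ = +-cancelˡ-≡ (i 0) _ _ (trans (sym (F-Σ 0 m)) I-round)

  open Periodic m n δ-per Σ-δ public

  I-mod : ∀ s → I s % n ≡ i (s % m)
  I-mod s = begin
    I s % n             ≡⟨ F-mod s ⟩
    I (s % m) % n       ≡⟨ cong (_% n) (I-inner (s % m) (m%n<n s m)) ⟩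
    i (s % m) % n       ≡⟨ m<n⇒m%n≡m (proj₁ en (s % m) (m%n<n s m)) ⟩
    i (s % m)           ∎
    where open ≡-Reasoning

  sumDelta≡ : ∀ j r → sumDelta n m i j r ≡ I (j + (suc r ∸ j)) ∸ I j
  sumDelta≡ j r = begin
    sum (map (λ u → δ (j + u)) (upTo (suc r ∸ j)))  ≡⟨ sum-upTo _ (suc r ∸ j) ⟩
    Σ< (suc r ∸ j) (λ u → δ (j + u))                ≡⟨ m+n∸m≡n (I j) _ ⟨
    I j + Σ< (suc r ∸ j) (λ u → δ (j + u)) ∸ I j    ≡⟨ cong (_∸ I j) (F-Σ j (suc r ∸ j)) ⟨
    I (j + (suc r ∸ j)) ∸ I j                       ∎
    where open ≡-Reasoning

no-unit-multiple : ∀ {k} → 2 ≤ k → ∀ a b → a * k ≡ b * k + 1 → ⊥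
no-unit-multiple {k} k≥2 a b ak≡bk+1 = <⇒≱ k≥2 (≤-reflexive k≡1)
  where
  k≡1 : k ≡ 1
  k≡1 = ∣1⇒≡1 (∣m+n∣m⇒∣n (divides a (sym ak≡bk+1)) (n∣m*n b))

quotient-bound : ∀ k .{{_ : NonZero k}} a b → a * k < b * k + 1 → a ≤ b
quotient-bound k a b ak<bk+1 = *-cancelʳ-≤ a b k (≤-pred (subst (a * k <_) (+-comm (b * k) 1) ak<bk+1))

module Alternation (n k : ℕ) .{{_ : NonZero n}} .{{_ : NonZero k}} (k≥2 : 2 ≤ k) (k+2≤n : k + 2 ≤ n)
  (d n₂ n₃ : ℕ) (i : ℕ → ℕ) (m' : ℕ) (en : Enumerates n (suc m') i) (d*n₃≡m : d * n₃ ≡ suc m')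
  (d≥2 : 2 ≤ d) (c : Fin d → SimpleCycle n k)
  (counts : ∀ a → nShort (c a) ≡ n₂ × nLong (c a) ≡ n₃)
  (disjoint : ∀ a b → a ≢ b → ∀ x → InN (c a) x → InN (c b) x → ⊥)
  (balance : 1 * n ≡ k * n₂ + (k + 1) * n₃)
  (alternated : ∀ (a : Fin d) x → InW (c a) x ⇔ (∃ λ t → t < n₃ × i (toℕ a + t * d) ≡ x)) where

  open LiftW n m' i en

  module CycleOf (a : Fin d) =
    Cycle n k k≥2 k+2≤n (c a) n₂ n₃ (proj₁ (counts a)) (proj₂ (counts a)) balance

  instance
    d-nonZero : NonZero d
    d-nonZero = >-nonZero (≤-trans (s≤s z≤n) d≥2)

  m≡n₃*d : m ≡ n₃ * d
  m≡n₃*d = trans (sym d*n₃≡m) (*-comm d n₃)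

  n₃-nonZero : NonZero n₃
  n₃-nonZero = nonZero-factor n₃ d*n₃≡m
    where
    nonZero-factor : ∀ t → d * t ≡ suc m' → NonZero t
    nonZero-factor zero    eq = ⊥-elim (0≢1+n (trans (sym (*-zeroʳ d)) eq))
    nonZero-factor (suc t) _  = _

  d≤m : d ≤ m
  d≤m = subst (d ≤_) d*n₃≡m (m≤m*n d n₃ {{n₃-nonZero}})

  -- index s belongs to the cycle of its class s mod d
  cls : ℕ → Fin d
  cls s = fromℕ< (m%n<n s d)

  toℕ-cls : ∀ s → toℕ (cls s) ≡ s % d
  toℕ-cls s = toℕ-fromℕ< (m%n<n s d)

  cls-cong : ∀ {s s'} → s % d ≡ s' % d → cls s ≡ cls s'
  cls-cong {s} {s'} eq = toℕ-injective (trans (toℕ-cls s) (trans eq (sym (toℕ-cls s'))))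

  mod-m-mod-d : ∀ s → s % m % d ≡ s % d
  mod-m-mod-d s = m∣n⇒o%n%m≡o%m d m s (divides n₃ m≡n₃*d)

  I∈W : ∀ s → InW (c (cls s)) (I s % n)
  I∈W s = Equivalence.from (alternated (cls s) (I s % n)) (s' / d , s'/d<n₃ , i-index)
    where
    s' = s % m
    s'/d<n₃ : s' / d < n₃
    s'/d<n₃ = m<n*o⇒m/o<n (subst (s' <_) m≡n₃*d (m%n<n s m))
    i-index : i (toℕ (cls s) + s' / d * d) ≡ I s % n
    i-index = begin
      i (toℕ (cls s) + s' / d * d)  ≡⟨ cong (λ r → i (r + s' / d * d)) (trans (toℕ-cls s) (sym (mod-m-mod-d s))) ⟩
      i (s' % d + s' / d * d)       ≡⟨ cong i (m≡m%n+[m/n]*n s' d) ⟨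
      i s'                          ≡⟨ I-mod s ⟨
      I s % n                       ∎
      where open ≡-Reasoning

  W-index : ∀ a {x} → InW (c a) x → ∃ λ s → s < m × s % d ≡ toℕ a × i s ≡ x
  W-index a {x} x∈W =
    let t , t<n₃ , i≡x = Equivalence.to (alternated a x) x∈W
    in  toℕ a + t * d
      , subst (toℕ a + t * d <_) (sym m≡n₃*d) (≤-trans (+-monoˡ-< (t * d) (toℕ<n a)) (*-monoˡ-≤ d t<n₃))
      , trans ([m+kn]%n≡m%n (toℕ a) t d) (m<n⇒m%n≡m (toℕ<n a))
      , i≡x

  next-in-class : ∀ j {y} → I j < y → y ≤ I j + n → InW (c (cls j)) (y % n) → I (j + d) ≤ y
  next-in-class j {y} Ij<y y≤ y∈W =
    let s , s<m , s≡j , is≡y = W-index (cls j) y∈W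
        t , j<t , _ , t≡s , It≡y = window {j} {s} Ij<y y≤ (trans (sym is≡y) (I-mod-inner s s<m))
        t≡j : j % d ≡ t % d
        t≡j = begin
          j % d          ≡⟨ toℕ-cls j ⟨
          toℕ (cls j)    ≡⟨ s≡j ⟨
          s % d          ≡⟨ mod-m-mod-d s ⟨
          s % m % d      ≡⟨ cong (_% d) t≡s ⟨
          t % m % d      ≡⟨ mod-m-mod-d t ⟩
          t % d          ∎
    in  subst (I (j + d) ≤_) It≡y (F-mono (congruent-gap d t≡j j<t))
    where
    open ≡-Reasoning
    I-mod-inner : ∀ s → s < m → i s ≡ I s % n
    I-mod-inner s s<m = sym (trans (I-mod s) (cong i (m<n⇒m%n≡m s<m)))

  module FromIndex (j : ℕ) where

    a : Fin d
    a = cls j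

    open SimpleCycle (c a) using (len; long; vert)
    open CycleOf a using (InN-vert; long⇒InW; InW⇒long; module Walk)

    start : InN (c a) (I j % n)
    start = proj₁ (I∈W j)

    l₀ : ℕ
    l₀ = proj₁ start

    open Walk l₀ (proj₁ (proj₂ start)) (I j) (sym (proj₂ (proj₂ start)))
      using (U; U-mod; walk-window; walk-linear) renaming (F-smono to U-smono)

    target≤ : I (j + d) ≤ I j + n
    target≤ = subst (I (j + d) ≤_) (F-period j) (F-mono (+-monoʳ-≤ j d≤m))

    target∈W : InW (c a) (I (j + d) % n)
    target∈W = subst (λ b → InW (c b) (I (j + d) % n)) (cls-cong ([m+n]%n≡m%n j d)) (I∈W (j + d))

    target-reached : ∃ λ q → 0 < q × q ≤ len × U q ≡ I (j + d)
    target-reached = walk-window (proj₁ target∈W) (F-smono (m<m+n j (≤-trans (s≤s z≤n) d≥2))) target≤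

    -- Before I (j + d) the walk uses no long arc: the head of a long arc lies in W^a,
    -- and would be a point of W^a strictly between I j and I (j + d).
    short-before : ∀ q → U q ≡ I (j + d) → ∀ r → suc r < q → long (l₀ + r) ≡ false
    short-before q Uq≡ r 1+r<q =
      ¬-not (λ is-long → <⇒≱ Ur<target (next-in-class j (U-smono {0} {suc r} z<s) Ur≤ (Ur∈W is-long)))
      where
      Ur<target : U (suc r) < I (j + d)
      Ur<target = subst (U (suc r) <_) Uq≡ (U-smono {suc r} {q} 1+r<q)
      Ur≤ : U (suc r) ≤ I j + n
      Ur≤ = ≤-trans (<⇒≤ Ur<target) target≤
      Ur∈W : long (l₀ + r) ≡ true → InW (c a) (U (suc r) % n)
      Ur∈W is-long = subst (InW (c a)) (trans (cong vert (sym (+-suc l₀ r))) (sym (U-mod (suc r))))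
                       (long⇒InW (l₀ + r) is-long)

    -- I (j + d) is in W^a, so the arc entering it is long.
    long-into-target : ∀ p → U (suc p) ≡ I (j + d) → long (l₀ + p) ≡ true
    long-into-target p Up≡ = InW⇒long (l₀ + p) (subst (InW (c a)) target≡ target∈W)
      where
      target≡ : I (j + d) % n ≡ vert (suc (l₀ + p))
      target≡ = trans (cong (_% n) (sym Up≡)) (trans (U-mod (suc p)) (cong vert (+-suc l₀ p)))

    arrival : ∃ λ p → I (j + d) ≡ I j + p * k + suc k × (∀ r → r ≤ p → InN (c a) ((I j + r * k) % n))
    arrival = arrive target-reached
      where
      arrive : (∃ λ q → 0 < q × q ≤ len × U q ≡ I (j + d)) →
               ∃ λ p → I (j + d) ≡ I j + p * k + suc k × (∀ r → r ≤ p → InN (c a) ((I j + r * k) % n))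
      arrive (suc p , _ , _ , Up≡) = p , I-eq , on-cycle
        where
        open ≡-Reasoning
        linear : ∀ r → r ≤ p → U r ≡ I j + r * k
        linear r r≤p = walk-linear r (λ r' r'<r → short-before (suc p) Up≡ r' (s≤s (≤-trans r'<r r≤p)))
        I-eq : I (j + d) ≡ I j + p * k + suc k
        I-eq = begin
          I (j + d)                          ≡⟨ Up≡ ⟨
          U p + (k + bit (long (l₀ + p)))    ≡⟨ cong₂ (λ u b → u + (k + bit b)) (linear p ≤-refl) (long-into-target p Up≡) ⟩
          I j + p * k + (k + 1)              ≡⟨ cong (I j + p * k +_) (+-comm k 1) ⟩
          I j + p * k + suc k                ∎
        on-cycle : ∀ r → r ≤ p → InN (c a) ((I j + r * k) % n)
        on-cycle r r≤p = subst (InN (c a)) (trans (sym (U-mod r)) (cong (_% n) (linear r r≤p))) (InN-vert (l₀ + r))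

  classes-differ : ∀ j e → 1 ≤ e → e < d → cls (j + e) ≢ cls j
  classes-differ j e 1≤e e<d same = <⇒≱ e<d (+-cancelˡ-≤ j d e (congruent-gap d residues (m<m+n j 1≤e)))
    where
    residues : j % d ≡ (j + e) % d
    residues = trans (sym (toℕ-cls j)) (trans (cong toℕ (sym same)) (toℕ-cls (j + e)))

  -- Suppose 1 ≤ e ≤ d gaps starting at j sum to q k, while
  -- I (j + d) = I j + p k + (k + 1) with I j + r k ∈ N^{j mod d} for r ≤ p.  Then e = d
  -- would give k ∣ 1, and q ≤ p would put I (j + e) ∈ W^{(j+e) mod d} on N^{j mod d};
  -- so q = p + 1, i.e. I (j + e) + 1 = I (j + d).
  block-before-arrival : ∀ j e p q → 1 ≤ e → e ≤ d →
    I (j + e) ≡ I j + q * k → I (j + d) ≡ I j + p * k + suc k →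
    (∀ r → r ≤ p → InN (c (cls j)) ((I j + r * k) % n)) →
    suc e ≡ d × δ (j + e) ≡ 1
  block-before-arrival j e p q 1≤e e≤d Ije Ijd on-cycle = by-length (m≤n⇒m<n∨m≡n e≤d)
    where
    Ijd' : I (j + d) ≡ I j + (suc p * k + 1)
    Ijd' = trans Ijd (regroup (I j) p k)
      where
      regroup : ∀ x p k → x + p * k + suc k ≡ x + ((1 + p) * k + 1)
      regroup = solve-∀

    by-quotient : e < d → q < suc p ⊎ q ≡ suc p → suc e ≡ d × δ (j + e) ≡ 1
    by-quotient e<d (inj₁ q≤p) =
      ⊥-elim (disjoint (cls (j + e)) (cls j) (classes-differ j e 1≤e e<d) (I (j + e) % n)
                (proj₁ (I∈W (j + e)))
                (subst (λ x → InN (c (cls j)) (x % n)) (sym Ije) (on-cycle q (≤-pred q≤p))))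
    by-quotient e<d (inj₂ q≡1+p) = F-just-before {j} {e} {d} e<d (begin
      I (j + e) + 1                 ≡⟨ cong (_+ 1) Ije ⟩
      I j + q * k + 1               ≡⟨ cong (λ t → I j + t * k + 1) q≡1+p ⟩
      I j + suc p * k + 1           ≡⟨ +-assoc (I j) (suc p * k) 1 ⟩
      I j + (suc p * k + 1)         ≡⟨ Ijd' ⟨
      I (j + d)                     ∎)
      where open ≡-Reasoning

    by-length : e < d ⊎ e ≡ d → suc e ≡ d × δ (j + e) ≡ 1
    by-length (inj₂ e≡d) = ⊥-elim (no-unit-multiple k≥2 q (suc p)
                             (+-cancelˡ-≡ (I j) _ _ (trans (sym Ije) (trans (cong (λ t → I (j + t)) e≡d) Ijd'))))
    by-length (inj₁ e<d) = by-quotient e<d (m≤n⇒m<n∨m≡n (quotient-bound k q (suc p)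
                             (+-cancelˡ-< (I j) _ _ (subst₂ _<_ Ije Ijd' (F-smono (+-monoʳ-< j e<d))))))

  divisible-block : ∀ j e → 1 ≤ e → e ≤ d → k ∣ I (j + e) ∸ I j → suc e ≡ d × δ (j + e) ≡ 1
  divisible-block j e 1≤e e≤d (divides q block≡) =
    let p , Ijd , on-cycle = FromIndex.arrival j
    in  block-before-arrival j e p q 1≤e e≤d Ije Ijd on-cycle
    where
    Ije : I (j + e) ≡ I j + q * k
    Ije = trans (sym (m+[n∸m]≡n (F-mono (m≤m+n j e)))) (cong (I j +_) block≡)

  -- Part (i): Σ_{s=j}^{r} δ_s ≡ 0 (mod k) with j ≤ r < j + d forces r = j + d - 2 and
  -- δ_{r+1} = 1; the sum is the block of r + 1 - j gaps starting at j.
  part-i : ∀ j r → j ≤ r → r < j + d → k ∣ sumDelta n m i j r → r ≡ j + d ∸ 2 × δ (suc r) ≡ 1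
  part-i j r j≤r r<j+d k∣sum = cong (_∸ 2) 2+r≡j+d , trans (cong δ (sym j+L≡1+r)) (proj₂ block)
    where
    L = suc r ∸ j
    j+L≡1+r : j + L ≡ suc r
    j+L≡1+r = m+[n∸m]≡n (m≤n⇒m≤1+n j≤r)
    L≤d : L ≤ d
    L≤d = ≤-trans (∸-monoˡ-≤ j r<j+d) (≤-reflexive (m+n∸m≡n j d))
    block : suc L ≡ d × δ (j + L) ≡ 1
    block = divisible-block j L (m<n⇒0<n∸m (s≤s j≤r)) L≤d (subst (k ∣_) (sumDelta≡ j r) k∣sum)
    2+r≡j+d : suc (suc r) ≡ j + d
    2+r≡j+d = trans (cong suc (sym j+L≡1+r)) (trans (sym (+-suc j L)) (cong (j +_) (proj₁ block)))

  -- Part (ii), one step: δ_s ≡ 1 (mod k) forces δ_{s+d} = 1.  With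
  -- I (s + d) = I s + D, D = p k + (k + 1), the d - 1 gaps after δ_s sum to D - δ_s,
  -- which is divisible by k.
  gap-step : ∀ s → δ s % k ≡ 1 % k → δ (s + d) ≡ 1
  gap-step s δ≡1 = let p , Isd , _ = FromIndex.arrival s in step-from p Isd
    where
    1≤d : 1 ≤ d
    1≤d = ≤-trans (s≤s z≤n) d≥2
    idx : s + d ≡ suc s + (d ∸ 1)
    idx = trans (cong (s +_) (sym (m+[n∸m]≡n 1≤d))) (+-suc s (d ∸ 1))
    step-from : ∀ p → I (s + d) ≡ I s + p * k + suc k → δ (s + d) ≡ 1
    step-from p Isd = trans (cong δ idx)
                        (proj₂ (divisible-block (suc s) (d ∸ 1) (∸-monoˡ-≤ 1 d≥2) (m∸n≤m d 1) k∣rest))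
      where
      D = p * k + suc k
      Iend : I (suc s + (d ∸ 1)) ≡ I s + D
      Iend = trans (cong I (sym idx)) (trans Isd (+-assoc (I s) (p * k) (suc k)))
      δ≤D : δ s ≤ D
      δ≤D = +-cancelˡ-≤ (I s) (δ s) D (subst (I (suc s) ≤_) Iend (F-mono (m≤m+n (suc s) (d ∸ 1))))
      D≡δ : D % k ≡ δ s % k
      D≡δ = trans (cong (_% k) (one-more p k)) (trans ([m+kn]%n≡m%n 1 (suc p) k) (sym δ≡1))
        where
        one-more : ∀ p k → p * k + suc k ≡ 1 + (1 + p) * k
        one-more = solve-∀
      k∣rest : k ∣ I (suc s + (d ∸ 1)) ∸ I (suc s)
      k∣rest = subst (k ∣_) (sym (trans (cong (_∸ I (suc s)) Iend) ([m+n]∸[m+o]≡n∸o (I s) D (δ s))))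
                 (congruent⇒∣∸ k D (δ s) D≡δ δ≤D)

  -- Part (ii): iterating the step along s, s + d, s + 2d, …, and closing up with
  -- the period m = n₃ d of δ.
  part-ii : ∀ s → δ s % k ≡ 1 % k → ∀ t → t < n₃ → δ (s + t * d) ≡ 1
  part-ii s δ≡1 = every
    where
    chain : ∀ t → δ (s + suc t * d) ≡ 1
    chain zero    = trans (cong (λ v → δ (s + v)) (+-identityʳ d)) (gap-step s δ≡1)
    chain (suc t) = trans (cong δ (next-multiple s t d)) (gap-step (s + suc t * d) (cong (_% k) (chain t)))
      where
      next-multiple : ∀ s t d → s + (2 + t) * d ≡ s + (1 + t) * d + d
      next-multiple = solve-∀
    full-round : ∀ N → m ≡ N * d → 1 ≤ N → δ (s + m) ≡ 1
    full-round (suc N) m≡ _ = subst (λ v → δ (s + v) ≡ 1) (sym m≡) (chain N)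
    every : ∀ t → t < n₃ → δ (s + t * d) ≡ 1
    every zero    0<n₃ = trans (cong δ (+-identityʳ s)) (trans (sym (δ-per s)) (full-round n₃ m≡n₃*d 0<n₃))
    every (suc t) _    = chain t

Assertions : (n k : ℕ) .{{_ : NonZero n}} .{{_ : NonZero k}} (d n₃ : ℕ) (i : ℕ → ℕ) (m : ℕ) → Set
Assertions n k d n₃ i m =
    (∀ j r → j < m → j ≤ r → r < j + d → k ∣ sumDelta n m i j r →
       (r ≡ j + d ∸ 2) × (delta n m i (suc r) ≡ 1))
  × (∀ s → s < d → delta n m i s % k ≡ 1 % k →
       ∀ t → t < n₃ → delta n m i (s + t * d) ≡ 1)

lemma4p9 : (n k : ℕ) .{{_ : NonZero n}} .{{_ : NonZero k}} →
    2 ≤ k → k + 2 ≤ n →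
    (d n₂ n₃ : ℕ) (i : ℕ → ℕ) →
    Enumerates n (d * n₃) i →
    DAlternated n k i d n₂ n₃ →
    (∀ j r → j < d * n₃ → j ≤ r → r < j + d →
       k ∣ sumDelta n (d * n₃) i j r →
       (r ≡ j + d ∸ 2) × (delta n (d * n₃) i (suc r) ≡ 1))
    × (∀ s → s < d → delta n (d * n₃) i s % k ≡ 1 % k →
       ∀ t → t < n₃ → delta n (d * n₃) i (s + t * d) ≡ 1)
lemma4p9 n k k≥2 k+2≤n d n₂ n₃ i en (d≥2 , _ , c , (counts , disjoint , _ , balance , _) , alternated) =
  assertions (d * n₃) refl en
  where
  assertions : ∀ m → d * n₃ ≡ m → Enumerates n m i → Assertions n k d n₃ i m
  assertions zero d*n₃≡0 _ = (λ _ _ ()) , (λ _ _ _ t t<n₃ → ⊥-elim (no-classes (<-≤-trans z<s t<n₃)))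
    where
    -- with W empty there are no indices t < n₃, since d ≥ 2
    no-classes : 1 ≤ n₃ → ⊥
    no-classes 1≤n₃ = <⇒≱ (≤-trans (s≤s z≤n) d≥2)
                        (≤-trans (subst (_≤ d * n₃) (*-identityʳ d) (*-monoʳ-≤ d 1≤n₃)) (≤-reflexive d*n₃≡0))
  assertions (suc m') d*n₃≡m en' = (λ j r _ → part-i j r) , (λ s _ → part-ii s)
    where
    open Alternation n k k≥2 k+2≤n d n₂ n₃ i m' en' d*n₃≡m d≥2 c counts disjoint balance alternated
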